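{- $(\mathsf{DMTS},\chi,\le_{\mathrm{sim}})$ is a specification theory for $\mathsf{LTS}$ which is adequate for simulation equivalence. That is, with $I\models D$ iff $\chi(I)\le_{\mathrm{sim}} D$, for every $I\in\mathsf{LTS}$ the DMTS $\chi(I)$ is a characteristic formula for $I$, and for all $I_1,I_2\in\mathsf{LTS}$, $I_1$ and $I_2$ satisfy exactly the same DMTS iff $I_1$ and $I_2$ are simulation equivalent.
   Context: Fix a finite alphabet $\Sigma$. An LTS is a tuple $(S,s^0,T)$ with $S$ a finite set, $s^0\in S$, $T\subseteq S\times\Sigma\times S$; $\mathsf{LTS}$ is the set of all LTS. A simulation from $(S_1,s^0_1,T_1)$ to $(S_2,s^0_2,T_2)$ is $R\subseteq S_1\times S_2$ with $(s^0_1,s^0_2)\in R$ such that for all $(s_1,s_2)\in R$ and $(s_1,a,t_1)\in T_1$ there is $(s_2,a,t_2)\in T_2$ with $(t_1,t_2)\in R$; two LTS are simulation equivalent if there are simulations in both directions. A DMTS is $D=(S,S^0,\dashrightarrow,\longrightarrow)$ with $S$ finite, $S^0\subseteq S$, $\dashrightarrow\subseteq S\times\Sigma\times S$ (may-transitions, written $s\overset{a}{\dashrightarrow}t$), and $\longrightarrow\subseteq S\times 2^{\Sigma\times S}$ (disjunctive must-transitions, written $s\longrightarrow N$), such that $s\longrightarrow N$ and $(a,t)\in N$ imply $s\overset{a}{\dashrightarrow}t$; $\mathsf{DMTS}$ is the set of all DMTS. For $I=(S,s^0,T)$ let $\chi(I)=(S,\{s^0\},T,\{(s,\{(a,t)\})\mid(s,a,t)\in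 T\})$. For DMTS $D_i=(S_i,S^0_i,\dashrightarrow_i,\longrightarrow_i)$, $D_1\le_{\mathrm{sim}}D_2$ iff there are $R_1,R_2\subseteq S_1\times S_2$ with: (1) every $s^0_1\in S^0_1$ has $s^0_2\in S^0_2$ with $(s^0_1,s^0_2)\in R_1$, and every $s^0_2\in S^0_2$ has $s^0_1\in S^0_1$ with $(s^0_1,s^0_2)\in R_2$; (2) for all $(s_1,s_2)\in R_1$ and $s_1\overset{a}{\dashrightarrow}_1t_1$ there is $s_2\overset{a}{\dashrightarrow}_2t_2$ with $(t_1,t_2)\in R_1$; (3) for all $(s_1,s_2)\in R_2$ and $s_2\longrightarrow_2N_2$ there is $s_1\longrightarrow_1N_1$ such that for every $(a,t_1)\in N_1$ there is $(a,t_2)\in N_2$ with $(t_1,t_2)\in R_2$. A specification theory for a set $\mathsf{Proc}$ is a triple $(\mathsf{Spec},\chi,\le)$, $\chi:\mathsf{Proc}\to\mathsf{Spec}$, $\le$ a preorder on $\mathsf{Spec}$, such that with $I\models S$ iff $\chi(I)\le S$, each $\chi(I)$ is a characteristic formula for $I$: $I\models\chi(I)$, and every $I'\models\chi(I)$ satisfies $\mathrm{Th}(I')=\mathrm{Th}(I)$ where $\mathrm{Th}(I)=\{S\mid I\models S\}$. It is adequate for an equivalence $\sim$ on $\mathsf{Proc}$ if $\mathrm{Th}(I_1)=\mathrm{Th}(I_2)\iff I_1\sim I_2$. -}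

module Defs where

open import Data.Nat using (ℕ)
open import Data.Fin using (Fin)
open import Data.Bool using (Bool; T)
open import Data.Product using (Σ; ∃; ∃-syntax; _×_; _,_; proj₁; proj₂)
open import Function.Bundles using (_⇔_; Equivalence)
open import Relation.Binary.PropositionalEquality using (_≡_; refl)

-- Alphabet Σ is Fin k (an arbitrary finite alphabet); state sets are Fin n.
-- Finite sets/relations over finite carriers are given as predicates.

record LTS (k : ℕ) : Set₁ where
  field
    n     : ℕ
    init  : Fin n
    trans : Fin n → Fin k → Fin n → Set

IsSimulation : ∀ {k} (I₁ I₂ : LTS k) → (Fin (LTS.n I₁) → Fin (LTS.n I₂) → Set) → Set
IsSimulation I₁ I₂ R =
  R (LTS.init I₁) (LTS.init I₂) ×
  (∀ s₁ s₂ → R s₁ s₂ → ∀ a t₁ → LTS.trans I₁ s₁ a t₁ →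
     ∃[ t₂ ] (LTS.trans I₂ s₂ a t₂ × R t₁ t₂))

Simulates : ∀ {k} → LTS k → LTS k → Set₁
Simulates I₁ I₂ = ∃[ R ] IsSimulation I₁ I₂ R

SimEquiv : ∀ {k} → LTS k → LTS k → Set₁
SimEquiv I₁ I₂ = Simulates I₁ I₂ × Simulates I₂ I₁

Subset : ℕ → ℕ → Set
Subset k n = Fin k → Fin n → Bool

record DMTS (k : ℕ) : Set₁ where
  field
    n    : ℕ
    init : Fin n → Set
    may  : Fin n → Fin k → Fin n → Set
    must : Fin n → Subset k n → Set           -- disjunctive must-transitions
    wf   : ∀ s N → must s N → ∀ a t → T (N a t) → may s a t

IsSingleton : ∀ {k n} → Subset k n → Fin k → Fin n → Set
IsSingleton N a t = ∀ a' t' → T (N a' t') ⇔ (a' ≡ a × t' ≡ t)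

χ : ∀ {k} → LTS k → DMTS k
χ {k} I = record
  { n    = LTS.n I
  ; init = λ s → s ≡ LTS.init I
  ; may  = LTS.trans I
  ; must = λ s N → ∃[ a ] ∃[ t ] (LTS.trans I s a t × IsSingleton N a t)
  ; wf   = λ { s N (a , t , tr , sg) a' t' m →
               wfh s N a t tr sg a' t' (Equivalence.to (sg a' t') m) }
  }
  where
  wfh : ∀ s N a t → LTS.trans I s a t → IsSingleton N a t →
        ∀ a' t' → (a' ≡ a × t' ≡ t) → LTS.trans I s a' t'
  wfh s N a t tr sg .a .t (refl , refl) = tr

module _ {k : ℕ} (D₁ D₂ : DMTS k) where
  private
    module D₁ = DMTS D₁
    module D₂ = DMTS D₂

  IsRefinement : (R₁ R₂ : Fin D₁.n → Fin D₂.n → Set) → Set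
  IsRefinement R₁ R₂ =
    (∀ s₁ → D₁.init s₁ → ∃[ s₂ ] (D₂.init s₂ × R₁ s₁ s₂)) ×
    (∀ s₂ → D₂.init s₂ → ∃[ s₁ ] (D₁.init s₁ × R₂ s₁ s₂)) ×
    (∀ s₁ s₂ → R₁ s₁ s₂ → ∀ a t₁ → D₁.may s₁ a t₁ →
       ∃[ t₂ ] (D₂.may s₂ a t₂ × R₁ t₁ t₂)) ×
    (∀ s₁ s₂ → R₂ s₁ s₂ → ∀ N₂ → D₂.must s₂ N₂ →
       ∃[ N₁ ] (D₁.must s₁ N₁ ×
         (∀ a t₁ → T (N₁ a t₁) → ∃[ t₂ ] (T (N₂ a t₂) × R₂ t₁ t₂))))

  _≤sim_ : Set₁
  _≤sim_ = ∃[ R₁ ] ∃[ R₂ ] IsRefinement R₁ R₂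

_⊨_ : ∀ {k} → LTS k → DMTS k → Set₁
I ⊨ D = χ I ≤sim D

SameTheory : ∀ {k} → LTS k → LTS k → Set₁
SameTheory I I' = ∀ D → (I ⊨ D) ⇔ (I' ⊨ D)

IsCharacteristic : ∀ {k} → LTS k → DMTS k → Set₁
IsCharacteristic I D = (I ⊨ D) × (∀ I' → I' ⊨ D → SameTheory I' I)

IsPreorderSim : ℕ → Set₁
IsPreorderSim k =
  (∀ (D : DMTS k) → D ≤sim D) ×
  (∀ (D₁ D₂ D₃ : DMTS k) → D₁ ≤sim D₂ → D₂ ≤sim D₃ → D₁ ≤sim D₃)

IsSpecTheory : ℕ → Set₁
IsSpecTheory k = IsPreorderSim k × (∀ (I : LTS k) → IsCharacteristic I (χ I))

AdequateForSimEquiv : ℕ → Set₁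
AdequateForSimEquiv k = ∀ (I₁ I₂ : LTS k) → SameTheory I₁ I₂ ⇔ SimEquiv I₁ I₂

-- χ I ≤sim χ J holds exactly when I and J are simulation equivalent: the
-- may-clause of refinement is a simulation from I to J, and since the must-sets
-- of χ are singletons, the must-clause is a simulation from J to I. Hence, by
-- transitivity of ≤sim, simulation-equivalent implementations have the same
-- theory, and conversely I₂ ⊨ χ I₂ transfers to I₁ ⊨ χ I₂.
module Submission where

open import Defs
open import Data.Nat using (ℕ)
open import Data.Fin using (Fin; _≟_)
open import Data.Bool using (T; _∧_)
open import Data.Bool.Properties using (T-∧)
open import Data.Product using (_×_; _,_; ∃-syntax)
open import Data.Product.Function.NonDependent.Propositional using (_×-⇔_)
open import Function.Base using (flip)
open import Function.Bundles using (_⇔_; mk⇔; Equivalence)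
open import Function.Construct.Composition using (_⇔-∘_)
open import Relation.Binary.PropositionalEquality using (_≡_; refl)
open import Relation.Nullary.Decidable using (Dec; ⌊_⌋; toWitness; fromWitness)

module _ {k n : ℕ} where

  singleton : Fin k → Fin n → Subset k n
  singleton a t a′ t′ = ⌊ a′ ≟ a ⌋ ∧ ⌊ t′ ≟ t ⌋

  singleton-isSingleton : ∀ a t → IsSingleton (singleton a t) a t
  singleton-isSingleton a t a′ t′ =
    (witness (a′ ≟ a) ×-⇔ witness (t′ ≟ t)) ⇔-∘ T-∧
    where
    witness : ∀ {P : Set} (P? : Dec P) → T ⌊ P? ⌋ ⇔ P
    witness P? = mk⇔ toWitness fromWitness

  singleton-member : ∀ a t a′ t′ → T (singleton a t a′ t′) → a′ ≡ a × t′ ≡ t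
  singleton-member a t a′ t′ = Equivalence.to (singleton-isSingleton a t a′ t′)

  IsSingleton-point : ∀ {a : Fin k} {t : Fin n} N → IsSingleton N a t → T (N a t)
  IsSingleton-point N N≈ = Equivalence.from (N≈ _ _) (refl , refl)

∃-one-point : ∀ {A : Set} {x : A} (P : A → Set) → ∃[ y ] (y ≡ x × P y) → P x
∃-one-point P (_ , refl , p) = p

module _ {k : ℕ} where

  ≤sim-refl : (D : DMTS k) → D ≤sim D
  ≤sim-refl D = _≡_ , _≡_ ,
    (λ s i → s , i , refl) ,
    (λ s i → s , i , refl) ,
    (λ { s .s refl a t m → t , m , refl }) ,
    (λ { s .s refl N m → N , m , λ a t x → t , x , refl })

  ≤sim-trans : (D₁ D₂ D₃ : DMTS k) → D₁ ≤sim D₂ → D₂ ≤sim D₃ → D₁ ≤sim D₃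
  ≤sim-trans D₁ D₂ D₃ (R₁ , R₂ , init₁ , init₂ , may , must)
                      (Q₁ , Q₂ , init₁′ , init₂′ , may′ , must′) =
    (λ s₁ s₃ → ∃[ s₂ ] (R₁ s₁ s₂ × Q₁ s₂ s₃)) ,
    (λ s₁ s₃ → ∃[ s₂ ] (R₂ s₁ s₂ × Q₂ s₂ s₃)) ,
    (λ s₁ i₁ → let (s₂ , i₂ , r) = init₁ s₁ i₁ ; (s₃ , i₃ , q) = init₁′ s₂ i₂
               in s₃ , i₃ , s₂ , r , q) ,
    (λ s₃ i₃ → let (s₂ , i₂ , q) = init₂′ s₃ i₃ ; (s₁ , i₁ , r) = init₂ s₂ i₂
               in s₁ , i₁ , s₂ , r , q) ,
    (λ { s₁ s₃ (s₂ , r , q) a t₁ tr₁ →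
         let (t₂ , tr₂ , r′) = may s₁ s₂ r a t₁ tr₁
             (t₃ , tr₃ , q′) = may′ s₂ s₃ q a t₂ tr₂
         in t₃ , tr₃ , t₂ , r′ , q′ }) ,
    (λ { s₁ s₃ (s₂ , r , q) N₃ m₃ →
         let (N₂ , m₂ , N₂⊑N₃) = must′ s₂ s₃ q N₃ m₃
             (N₁ , m₁ , N₁⊑N₂) = must s₁ s₂ r N₂ m₂
         in N₁ , m₁ , λ a t₁ x₁ →
              let (t₂ , x₂ , r′) = N₁⊑N₂ a t₁ x₁
                  (t₃ , x₃ , q′) = N₂⊑N₃ a t₂ x₂
              in t₃ , x₃ , t₂ , r′ , q′ })

SimulationStep : ∀ {k} (I J : LTS k) → (Fin (LTS.n I) → Fin (LTS.n J) → Set) → Set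
SimulationStep I J R = ∀ s₁ s₂ → R s₁ s₂ → ∀ a t₁ → LTS.trans I s₁ a t₁ →
                       ∃[ t₂ ] (LTS.trans J s₂ a t₂ × R t₁ t₂)

module _ {k : ℕ} (I J : LTS k) where

  private
    module I = LTS I
    module J = LTS J

  MustRefines : (Fin I.n → Fin J.n → Set) → Set
  MustRefines R = ∀ s₁ s₂ → R s₁ s₂ → ∀ N₂ → DMTS.must (χ J) s₂ N₂ →
    ∃[ N₁ ] (DMTS.must (χ I) s₁ N₁ ×
      (∀ a t₁ → T (N₁ a t₁) → ∃[ t₂ ] (T (N₂ a t₂) × R t₁ t₂)))

  simulationStep⇒mustRefines : ∀ {R} → SimulationStep J I (flip R) → MustRefines R
  simulationStep⇒mustRefines {R} step s₁ s₂ r N₂ (a , t₂ , tr₂ , N₂≈) =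
    let (t₁ , tr₁ , r′) = step s₂ s₁ r a t₂ tr₂
    in singleton a t₁ , (a , t₁ , tr₁ , singleton-isSingleton a t₁) ,
       λ a′ t₁′ x → answer (singleton-member a t₁ a′ t₁′ x) r′
    where
    answer : ∀ {a′ t₁′ t₁} → a′ ≡ a × t₁′ ≡ t₁ → R t₁ t₂ →
             ∃[ t ] (T (N₂ a′ t) × R t₁′ t)
    answer (refl , refl) r′ = t₂ , IsSingleton-point N₂ N₂≈ , r′

  mustRefines⇒simulationStep : ∀ {R} → MustRefines R → SimulationStep J I (flip R)
  mustRefines⇒simulationStep {R} must s₂ s₁ r a t₂ tr₂
    with must s₁ s₂ r (singleton a t₂) (a , t₂ , tr₂ , singleton-isSingleton a t₂)
  ... | N₁ , (a′ , t₁ , tr₁ , N₁≈) , N₁⊑N₂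
    with N₁⊑N₂ a′ t₁ (IsSingleton-point N₁ N₁≈)
  ... | t , x , r′
    with singleton-member a t₂ a′ t x
  ... | refl , refl = t₁ , tr₁ , r′

  simEquiv⇒χ≤sim : SimEquiv I J → χ I ≤sim χ J
  simEquiv⇒χ≤sim ((R , R-init , R-step) , (Q , Q-init , Q-step)) =
    R , flip Q ,
    (λ { _ refl → J.init , refl , R-init }) ,
    (λ { _ refl → I.init , refl , Q-init }) ,
    R-step ,
    simulationStep⇒mustRefines Q-step

  χ≤sim⇒simEquiv : χ I ≤sim χ J → SimEquiv I J
  χ≤sim⇒simEquiv (R₁ , R₂ , init₁ , init₂ , may , must) =
    (R₁ , ∃-one-point (R₁ I.init) (init₁ I.init refl) , may) ,
    (flip R₂ , ∃-one-point (flip R₂ J.init) (init₂ J.init refl) ,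
     mustRefines⇒simulationStep must)

module _ {k : ℕ} (I J : LTS k) where

  simEquiv⇒sameTheory : SimEquiv I J → SameTheory I J
  simEquiv⇒sameTheory (I≲J , J≲I) D =
    mk⇔ (≤sim-trans (χ J) (χ I) D (simEquiv⇒χ≤sim J I (J≲I , I≲J)))
        (≤sim-trans (χ I) (χ J) D (simEquiv⇒χ≤sim I J (I≲J , J≲I)))

  sameTheory⇒simEquiv : SameTheory I J → SimEquiv I J
  sameTheory⇒simEquiv same =
    χ≤sim⇒simEquiv I J (Equivalence.from (same (χ J)) (≤sim-refl (χ J)))

theorem1 : ∀ (k : ℕ) → IsSpecTheory k × AdequateForSimEquiv k
theorem1 k =
  ((≤sim-refl , ≤sim-trans) ,
   λ I → ≤sim-refl (χ I) ,
         λ I′ I′⊨χI → simEquiv⇒sameTheory I′ I (χ≤sim⇒simEquiv I′ I I′⊨χI)) ,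
  λ I₁ I₂ → mk⇔ (sameTheory⇒simEquiv I₁ I₂) (simEquiv⇒sameTheory I₁ I₂)
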